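{- Let $A=\{a_1<\dots<a_m\}\subseteq[n]$. For every $A$-central function $f\colon A\to[m]$ one has $f=\overline{S(f)}$. Conversely, for every $w\in W_A$ one has $w=S(\overline{w})$.
   Context: $[k]=\{1,\dots,k\}$. $W_A$ is the set of words $w=w_1\cdots w_m$ in which each element of $A$ appears exactly once, and $w^{ -1}(w_i)=i$. A function $f\colon A\to[m]$ is $A$-central if $f(a_j)\le j$ for all $j\in[m]$. Contraction: $\overline{w}\colon A\to[m]$, $\overline{w}(a)=w^{ -1}(a)-|\{b\in A: b>a,\ w^{ -1}(b)<w^{ -1}(a)\}|$. S-parking: for $f\colon A\to[m]$ with $f(a_i)\le i$ for all $i$, let $A_i=\{a_1,\dots,a_i\}$ and define bijections $w^i\colon A_i\to[i]$ recursively by $w^1(a_1)=1$ and, for $1<i\le m$: $w^i(a_i)=f(a_i)$, and for $j<i$, $w^i(a_j)=w^{i-1}(a_j)$ if $w^{i-1}(a_j)<f(a_i)$ and $w^i(a_j)=w^{i-1}(a_j)+1$ if $w^{i-1}(a_j)\ge f(a_i)$. With $\psi=(w^m)^{ -1}\colon[m]\to A$, the s-parking of $f$ is the word $S(f)=\psi(1)\psi(2)\cdots\psi(m)\in W_A$. -}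

module Defs where

open import Data.Nat using (ℕ; zero; suc; _∸_; _≤_; _<_; _<ᵇ_; _≡ᵇ_)
open import Data.Bool using (Bool; true; false; if_then_else_; _∧_)
open import Data.Fin using (Fin; toℕ) renaming (zero to fz; suc to fs; _<_ to _<F_)
open import Data.Product using (_×_; ∃; Σ)
open import Relation.Binary.PropositionalEquality using (_≡_)

-- Conventions: A = {a_1 < ... < a_m} is given by a : Fin m → ℕ, where
-- a j (j : Fin m, 0-based) is a_{j+1}.  A function g : A → ℕ is given by
-- its values g j = g(a_{j+1}).  A word w = w_1 ... w_m is w : Fin m → ℕ,
-- w i = w_{i+1}.  Positions / values in [m] are 1-based naturals.

count : ∀ {m} → (Fin m → Bool) → ℕ
count {zero} p = 0
count {suc m} p = (if p fz then 1 else 0) Data.Nat.+ count (λ k → p (fs k))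

-- 0-based index of the first position i with w i = x (m if none)
firstIndex : ∀ {m} → (Fin m → ℕ) → ℕ → ℕ
firstIndex {zero} w x = 0
firstIndex {suc m} w x = if w fz ≡ᵇ x then 0 else suc (firstIndex (λ i → w (fs i)) x)

winv : ∀ {m} → (Fin m → ℕ) → ℕ → ℕ
winv w x = suc (firstIndex w x)

pick : ∀ {m} → (Fin m → Bool) → (Fin m → ℕ) → ℕ
pick {zero} p v = 0
pick {suc m} p v = if p fz then v fz else pick (λ j → p (fs j)) (λ j → v (fs j))

at : ∀ {m} → (Fin m → ℕ) → ℕ → ℕ
at {zero} f j = 0
at {suc m} f zero = f fz
at {suc m} f (suc j) = at (λ k → f (fs k)) j

IsSubsetSeq : (n m : ℕ) → (Fin m → ℕ) → Set
IsSubsetSeq n m a = (∀ j → 1 ≤ a j × a j ≤ n) × (∀ i j → i <F j → a i < a j)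

Central : ∀ {m} → (Fin m → ℕ) → Set
Central f = ∀ j → 1 ≤ f j × f j ≤ suc (toℕ j)

InW : ∀ {m} → (Fin m → ℕ) → (Fin m → ℕ) → Set
InW a w = (∀ i → ∃ λ j → w i ≡ a j)
        × (∀ j → Σ _ λ i → (w i ≡ a j) × (∀ i' → w i' ≡ a j → i' ≡ i))

contract : ∀ {m} → (Fin m → ℕ) → (Fin m → ℕ) → (Fin m → ℕ)
contract a w j =
  winv w (a j) ∸ count (λ k → (a j <ᵇ a k) ∧ (winv w (a k) <ᵇ winv w (a j)))

-- w^i(a_{j+1}) for 0-based j < i, i ≥ 1 (f read 0-based via f' = at f)
wmap : (ℕ → ℕ) → ℕ → ℕ → ℕ
wmap f zero j = 0
wmap f (suc zero) j = 1
wmap f (suc (suc i)) j =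
  if j ≡ᵇ suc i then f (suc i)
  else (if wmap f (suc i) j <ᵇ f (suc i) then wmap f (suc i) j
        else suc (wmap f (suc i) j))

-- s-parking: S(f)_p = ψ(p) where ψ = (w^m)⁻¹, p 1-based
sparking : ∀ {m} → (Fin m → ℕ) → (Fin m → ℕ) → (Fin m → ℕ)
sparking {m} a f p = pick (λ j → wmap (at f) m (toℕ j) ≡ᵇ suc (toℕ p)) a

-- Write W i j for w^i(a_{j+1}) (the function wmap of Defs, 0-based j < i).
-- Step i+1 of s-parking puts the new letter at value c = f(a_{i+1}) and relabels
-- every old value v by the insertion map  ins c v = (v < c ? v : v + 1).
--
-- * Parking:  for an A-central f, each W i is a bijection [0,i) → [1,i]
--   (proved by induction on the number of parked letters), and
--   W i j = f(a_{j+1}) + #{k < i : j < k, W i k < W i j}   ("parking code").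
--   Since the letter a_{k+1} stands in S(f) at position W m k and a is
--   increasing, the right-hand count is exactly the one subtracted in the
--   contraction, so  contract(S(f)) = f.
-- * Ranking:  if P is injective and G x = 1 + #{k < x : P k < P x} for all x,
--   then parking G ranks P:  W i j = 1 + #{k < i : P k < P j}.
--   For w ∈ W_A let P k be the position of a_{k+1} in w; P is a permutation,
--   so P x = #{k : P k < P x}, and splitting this count at x shows that the
--   contraction of w has exactly the shape of G.  Hence W m = 1 + P, i.e. the
--   s-parking of the contraction puts every letter back at its place in w.

module Submission where

open import Defs
open import Data.Nat using (ℕ; zero; suc; _+_; _∸_; _≤_; _<_; _<ᵇ_; _≡ᵇ_; z≤n; s≤s)
open import Data.Nat.Properties
open import Algebra.Properties.CommutativeSemigroup +-commutativeSemigroup using (interchange)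
open import Data.Bool using (Bool; true; false; if_then_else_; _∧_; not; T)
open import Data.Bool.Properties using (∧-zeroʳ)
open import Data.Fin using (Fin; toℕ; fromℕ<) renaming (zero to fz; suc to fs)
open import Data.Fin.Properties using (toℕ-injective; toℕ-fromℕ<; toℕ<n) renaming (suc-injective to fs-injective)
open import Data.Product using (_×_; ∃; _,_; proj₁; proj₂)
open import Data.Sum using (_⊎_; inj₁; inj₂)
open import Data.Empty using (⊥-elim)
open import Data.Unit using (tt)
open import Relation.Binary.Definitions using (tri<; tri≈; tri>)
open import Relation.Binary.PropositionalEquality

<ᵇ-true : ∀ {x y} → x < y → (x <ᵇ y) ≡ true
<ᵇ-true {x} {y} x<y with x <ᵇ y | <⇒<ᵇ x<y
... | true | _ = refl
... | false | ()

<ᵇ-sound : ∀ {x y} → (x <ᵇ y) ≡ true → x < y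
<ᵇ-sound {x} {y} e = <ᵇ⇒< x y (subst T (sym e) tt)

<ᵇ-false : ∀ {x y} → y ≤ x → (x <ᵇ y) ≡ false
<ᵇ-false {x} {y} y≤x with x <ᵇ y in e
... | false = refl
... | true = ⊥-elim (<⇒≱ (<ᵇ-sound e) y≤x)

<ᵇ-irrefl : ∀ x → (x <ᵇ x) ≡ false
<ᵇ-irrefl x = <ᵇ-false {x} {x} ≤-refl

<ᵇ-sound-false : ∀ {x y} → (x <ᵇ y) ≡ false → y ≤ x
<ᵇ-sound-false e = ≮⇒≥ (λ x<y → true≢false (trans (sym (<ᵇ-true x<y)) e))
  where
  true≢false : true ≢ false
  true≢false ()

≡ᵇ-sound : ∀ {x y} → (x ≡ᵇ y) ≡ true → x ≡ y
≡ᵇ-sound {x} {y} e = ≡ᵇ⇒≡ x y (subst T (sym e) tt)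

≡ᵇ-true : ∀ {x y} → x ≡ y → (x ≡ᵇ y) ≡ true
≡ᵇ-true {x} {y} x≡y with x ≡ᵇ y | ≡⇒≡ᵇ x y x≡y
... | true | _ = refl
... | false | ()

≡ᵇ-false : ∀ {x y} → x ≢ y → (x ≡ᵇ y) ≡ false
≡ᵇ-false {x} {y} x≢y with x ≡ᵇ y in e
... | false = refl
... | true = ⊥-elim (x≢y (≡ᵇ-sound e))

⟦_⟧ : Bool → ℕ
⟦ b ⟧ = if b then 1 else 0

countBelow : ℕ → (ℕ → Bool) → ℕ
countBelow zero p = 0
countBelow (suc n) p = countBelow n p + ⟦ p n ⟧

restrict : ∀ {n} {Q : ℕ → Set} → (∀ k → k < suc n → Q k) → ∀ k → k < n → Q k
restrict h k k<n = h k (m<n⇒m<1+n k<n)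

⟦⟧-mono : ∀ {b c} → (b ≡ true → c ≡ true) → ⟦ b ⟧ ≤ ⟦ c ⟧
⟦⟧-mono {false} b⇒c = z≤n
⟦⟧-mono {true} b⇒c rewrite b⇒c refl = ≤-refl

countBelow-ext : ∀ n {p q : ℕ → Bool} → (∀ k → k < n → p k ≡ q k) →
  countBelow n p ≡ countBelow n q
countBelow-ext zero h = refl
countBelow-ext (suc n) h = cong₂ _+_ (countBelow-ext n (restrict h)) (cong ⟦_⟧ (h n ≤-refl))

countBelow-mono : ∀ n {p q : ℕ → Bool} → (∀ k → k < n → p k ≡ true → q k ≡ true) →
  countBelow n p ≤ countBelow n q
countBelow-mono zero h = z≤n
countBelow-mono (suc n) h = +-mono-≤ (countBelow-mono n (restrict h)) (⟦⟧-mono (h n ≤-refl))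

countBelow-strict : ∀ n {p q : ℕ → Bool} → (∀ k → k < n → p k ≡ true → q k ≡ true) →
  ∀ j → j < n → p j ≡ false → q j ≡ true → countBelow n p < countBelow n q
countBelow-strict (suc n) h j j<1+n pj qj with m≤n⇒m<n∨m≡n (≤-pred j<1+n)
... | inj₁ j<n = +-mono-<-≤ (countBelow-strict n (restrict h) j j<n pj qj) (⟦⟧-mono (h n ≤-refl))
... | inj₂ refl rewrite pj | qj = +-mono-≤-< (countBelow-mono j (restrict h)) (s≤s z≤n)

countBelow-none : ∀ n {p : ℕ → Bool} → (∀ k → k < n → p k ≡ false) → countBelow n p ≡ 0
countBelow-none zero h = refl
countBelow-none (suc n) h rewrite h n ≤-refl | countBelow-none n (restrict h) = refl

countBelow-one : ∀ n {p : ℕ → Bool} x → x < n → p x ≡ true →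
  (∀ y → y < n → p y ≡ true → y ≡ x) → countBelow n p ≡ 1
countBelow-one (suc n) {p} x x<1+n px unique with m≤n⇒m<n∨m≡n (≤-pred x<1+n)
... | inj₁ x<n rewrite countBelow-one n x x<n px (restrict unique) = cong suc pn≡0
  where
  pn≡0 : ⟦ p n ⟧ ≡ 0
  pn≡0 with p n in e
  ... | false = refl
  ... | true = ⊥-elim (<-irrefl (sym (unique n ≤-refl e)) x<n)
... | inj₂ refl rewrite px = cong (_+ 1) (countBelow-none x λ k k<x → false-below k k<x)
  where
  false-below : ∀ k → k < x → p k ≡ false
  false-below k k<x with p k in e
  ... | false = refl
  ... | true = ⊥-elim (<-irrefl (unique k (m<n⇒m<1+n k<x) e) k<x)

countBelow-sum : ∀ n {p q r : ℕ → Bool} → (∀ k → k < n → ⟦ r k ⟧ ≡ ⟦ p k ⟧ + ⟦ q k ⟧) →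
  countBelow n r ≡ countBelow n p + countBelow n q
countBelow-sum zero h = refl
countBelow-sum (suc n) {p} {q} {r} h = begin
  countBelow n r + ⟦ r n ⟧
    ≡⟨ cong₂ _+_ (countBelow-sum n (restrict h)) (h n ≤-refl) ⟩
  (countBelow n p + countBelow n q) + (⟦ p n ⟧ + ⟦ q n ⟧)
    ≡⟨ interchange (countBelow n p) (countBelow n q) ⟦ p n ⟧ ⟦ q n ⟧ ⟩
  (countBelow n p + ⟦ p n ⟧) + (countBelow n q + ⟦ q n ⟧) ∎
  where open ≡-Reasoning

countBelow-split : ∀ n (q p : ℕ → Bool) →
  countBelow n p ≡ countBelow n (λ k → q k ∧ p k) + countBelow n (λ k → not (q k) ∧ p k)
countBelow-split n q p = countBelow-sum n (λ k _ → split (q k) (p k))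
  where
  split : ∀ b c → ⟦ c ⟧ ≡ ⟦ b ∧ c ⟧ + ⟦ not b ∧ c ⟧
  split true c = sym (+-identityʳ ⟦ c ⟧)
  split false c = refl

countBelow-prefix : ∀ n i {p : ℕ → Bool} → i ≤ n →
  countBelow n (λ k → (k <ᵇ i) ∧ p k) ≡ countBelow i p
countBelow-prefix zero .zero z≤n = refl
countBelow-prefix (suc n) i {p} i≤1+n with m≤n⇒m<n∨m≡n i≤1+n
... | inj₁ i<1+n rewrite countBelow-prefix n i {p} (≤-pred i<1+n) | <ᵇ-false {n} {i} (≤-pred i<1+n) =
  +-identityʳ _
... | inj₂ refl = cong₂ _+_
  (countBelow-ext n (λ k k<n → cong (_∧ p k) (<ᵇ-true (m<n⇒m<1+n k<n))))
  (cong (λ b → ⟦ b ∧ p n ⟧) (<ᵇ-true {n} {suc n} ≤-refl))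

countBelow-front : ∀ n (p : ℕ → Bool) → countBelow (suc n) p ≡ ⟦ p 0 ⟧ + countBelow n (λ k → p (suc k))
countBelow-front zero p = +-comm 0 ⟦ p 0 ⟧
countBelow-front (suc n) p rewrite countBelow-front n p = +-assoc ⟦ p 0 ⟧ _ _

permutation-rank : ∀ m (g : ℕ → ℕ) → (∀ x y → x < m → y < m → g x ≡ g y → x ≡ y) →
  (∀ t → t < m → ∃ λ x → x < m × g x ≡ t) →
  ∀ t → t ≤ m → countBelow m (λ k → g k <ᵇ t) ≡ t
permutation-rank m g inj surj zero _ = countBelow-none m (λ k _ → refl)
permutation-rank m g inj surj (suc t) t<m = begin
  countBelow m (λ k → g k <ᵇ suc t)
    ≡⟨ countBelow-sum m (λ k _ → below-suc (g k)) ⟩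
  countBelow m (λ k → g k <ᵇ t) + countBelow m (λ k → g k ≡ᵇ t)
    ≡⟨ cong₂ _+_ (permutation-rank m g inj surj t (<⇒≤ t<m)) hit-once ⟩
  t + 1
    ≡⟨ +-comm t 1 ⟩
  suc t ∎
  where
  open ≡-Reasoning
  below-suc : ∀ x → ⟦ x <ᵇ suc t ⟧ ≡ ⟦ x <ᵇ t ⟧ + ⟦ x ≡ᵇ t ⟧
  below-suc x with <-cmp x t
  ... | tri< x<t _ _ rewrite <ᵇ-true {x} {suc t} (m<n⇒m<1+n x<t) | <ᵇ-true x<t | ≡ᵇ-false (<⇒≢ x<t) = refl
  ... | tri≈ _ refl _ rewrite <ᵇ-true {x} {suc x} ≤-refl | <ᵇ-irrefl x | ≡ᵇ-true (refl {x = x}) = refl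
  ... | tri> _ _ t<x rewrite <ᵇ-false {x} {suc t} t<x | <ᵇ-false {x} {t} (<⇒≤ t<x) | ≡ᵇ-false (≢-sym (<⇒≢ t<x)) = refl
  preimage = surj t t<m
  hit-once : countBelow m (λ k → g k ≡ᵇ t) ≡ 1
  hit-once = countBelow-one m (proj₁ preimage) (proj₁ (proj₂ preimage)) (≡ᵇ-true (proj₂ (proj₂ preimage)))
    (λ y y<m e → inj y _ y<m (proj₁ (proj₂ preimage)) (trans (≡ᵇ-sound e) (sym (proj₂ (proj₂ preimage)))))

rank : (ℕ → ℕ) → ℕ → ℕ → ℕ
rank P i j = countBelow i (λ k → P k <ᵇ P j)

-- For a permutation P (with P x = rank P m x), the right inversions of x are what
-- separates 1 + P x from 1 + its left inversions.  This is the shape of a contraction.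
right-inversions : ∀ m (P : ℕ → ℕ) → (∀ x → x < m → P x ≡ rank P m x) → ∀ x → x < m →
  suc (P x) ∸ countBelow m (λ l → (x <ᵇ l) ∧ (P l <ᵇ P x)) ≡ suc (rank P x x)
right-inversions m P P-rank x x<m = begin
  suc (P x) ∸ right
    ≡⟨ cong (λ v → suc v ∸ right) (P-rank x x<m) ⟩
  suc (rank P m x) ∸ right
    ≡⟨ cong (λ v → suc v ∸ right) (countBelow-split m (_<ᵇ x) (smaller)) ⟩
  suc (countBelow m (λ l → (l <ᵇ x) ∧ smaller l) + countBelow m (λ l → not (l <ᵇ x) ∧ smaller l)) ∸ right
    ≡⟨ cong₂ (λ u v → suc (u + v) ∸ right) (countBelow-prefix m x (<⇒≤ x<m)) (countBelow-ext m not-before) ⟩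
  suc (rank P x x) + right ∸ right
    ≡⟨ m+n∸n≡m (suc (rank P x x)) right ⟩
  suc (rank P x x) ∎
  where
  open ≡-Reasoning
  smaller : ℕ → Bool
  smaller l = P l <ᵇ P x
  right = countBelow m (λ l → (x <ᵇ l) ∧ smaller l)
  not-before : ∀ l → l < m → (not (l <ᵇ x) ∧ smaller l) ≡ ((x <ᵇ l) ∧ smaller l)
  not-before l _ with <-cmp l x
  ... | tri< l<x _ _ rewrite <ᵇ-true l<x | <ᵇ-false {x} {l} (<⇒≤ l<x) = refl
  ... | tri≈ _ refl _ rewrite <ᵇ-irrefl (P x) = trans (∧-zeroʳ _) (sym (∧-zeroʳ _))
  ... | tri> _ _ x<l rewrite <ᵇ-true x<l | <ᵇ-false {l} {x} (<⇒≤ x<l) = refl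

ins : ℕ → ℕ → ℕ
ins c v = if v <ᵇ c then v else suc v

ins-below : ∀ {c v} → v < c → ins c v ≡ v
ins-below v<c rewrite <ᵇ-true v<c = refl

ins-above : ∀ {c v} → c ≤ v → ins c v ≡ suc v
ins-above {c} {v} c≤v rewrite <ᵇ-false {v} {c} c≤v = refl

ins-cases : ∀ c v → (v < c × ins c v ≡ v) ⊎ (c ≤ v × ins c v ≡ suc v)
ins-cases c v with v <ᵇ c in e
... | true = inj₁ (<ᵇ-sound e , refl)
... | false = inj₂ (<ᵇ-sound-false e , refl)

ins-≥ : ∀ c v → v ≤ ins c v
ins-≥ c v with ins-cases c v
... | inj₁ (_ , e) = ≤-reflexive (sym e)
... | inj₂ (_ , e) = ≤-trans (n≤1+n v) (≤-reflexive (sym e))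

ins-≤ : ∀ c v → ins c v ≤ suc v
ins-≤ c v with ins-cases c v
... | inj₁ (_ , e) = ≤-trans (≤-reflexive e) (n≤1+n v)
... | inj₂ (_ , e) = ≤-reflexive e

ins-order : ∀ c x y → (ins c x <ᵇ ins c y) ≡ (x <ᵇ y)
ins-order c x y with x <ᵇ c in ex | y <ᵇ c in ey
... | true | true = refl
... | false | false = refl
... | true | false = trans (<ᵇ-true {x} {suc y} (m<n⇒m<1+n x<y)) (sym (<ᵇ-true x<y))
  where
  x<y : x < y
  x<y = <-≤-trans (<ᵇ-sound {x} {c} ex) (<ᵇ-sound-false {y} {c} ey)
... | false | true = trans (<ᵇ-false {suc x} {y} (m≤n⇒m≤1+n y≤x)) (sym (<ᵇ-false {x} {y} y≤x))
  where
  y≤x : y ≤ x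
  y≤x = ≤-trans (<⇒≤ (<ᵇ-sound {y} {c} ey)) (<ᵇ-sound-false {x} {c} ex)

ins-injective : ∀ c x y → ins c x ≡ ins c y → x ≡ y
ins-injective c x y e with <-cmp x y
... | tri< x<y _ _ = ⊥-elim (<-irrefl e (<ᵇ-sound (trans (ins-order c x y) (<ᵇ-true x<y))))
... | tri≈ _ x≡y _ = x≡y
... | tri> _ _ y<x = ⊥-elim (<-irrefl (sym e) (<ᵇ-sound (trans (ins-order c y x) (<ᵇ-true y<x))))

ins-avoids : ∀ c v → ins c v ≢ c
ins-avoids c v e with ins-cases c v
... | inj₁ (v<c , ev) = <-irrefl (trans (sym ev) e) v<c
... | inj₂ (c≤v , ev) = <-irrefl (sym (trans (sym ev) e)) (s≤s c≤v)

ins-shift : ∀ c v → ins c v ≡ v + ⟦ c <ᵇ ins c v ⟧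
ins-shift c v with ins-cases c v
... | inj₁ (v<c , ev) rewrite ev | <ᵇ-false {c} {v} (<⇒≤ v<c) = sym (+-identityʳ v)
... | inj₂ (c≤v , ev) rewrite ev | <ᵇ-true {c} {suc v} (s≤s c≤v) = +-comm 1 v

wmap-new : ∀ F i → wmap F (suc (suc i)) (suc i) ≡ F (suc i)
wmap-new F i rewrite ≡ᵇ-true (refl {x = i}) = refl

wmap-old : ∀ F i j → j < suc i → wmap F (suc (suc i)) j ≡ ins (F (suc i)) (wmap F (suc i) j)
wmap-old F i j j<1+i rewrite ≡ᵇ-false {j} {suc i} (<⇒≢ j<1+i) = refl

module Parking (F : ℕ → ℕ) (m : ℕ) (central : ∀ k → k < m → 1 ≤ F k × F k ≤ suc k) where

  W : ℕ → ℕ → ℕ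
  W = wmap F

  -- The lemmas below describe W (i + 1), the state after parking i + 1 letters.

  W-range : ∀ i → suc i ≤ m → ∀ j → j < suc i → 1 ≤ W (suc i) j × W (suc i) j ≤ suc i
  W-range zero _ zero _ = s≤s z≤n , s≤s z≤n
  W-range zero _ (suc j) (s≤s ())
  W-range (suc i) i<m j j< with m≤n⇒m<n∨m≡n (≤-pred j<)
  ... | inj₂ refl rewrite wmap-new F i = central (suc i) i<m
  ... | inj₁ j<i rewrite wmap-old F i j j<i with W-range i (<⇒≤ i<m) j j<i
  ...   | lo , hi = ≤-trans lo (ins-≥ (F (suc i)) _) , ≤-trans (ins-≤ (F (suc i)) _) (s≤s hi)

  W-injective : ∀ i → suc i ≤ m → ∀ j j' → j < suc i → j' < suc i → W (suc i) j ≡ W (suc i) j' → j ≡ j'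
  W-injective zero _ zero zero _ _ _ = refl
  W-injective zero _ (suc j) _ (s≤s ()) _ _
  W-injective zero _ _ (suc j') _ (s≤s ()) _
  W-injective (suc i) i<m j j' j< j'< e
    with m≤n⇒m<n∨m≡n (≤-pred j<) | m≤n⇒m<n∨m≡n (≤-pred j'<)
  ... | inj₂ refl | inj₂ refl = refl
  ... | inj₁ j<i | inj₁ j'<i = W-injective i (<⇒≤ i<m) j j' j<i j'<i
        (ins-injective (F (suc i)) _ _ (trans (sym (wmap-old F i j j<i)) (trans e (wmap-old F i j' j'<i))))
  ... | inj₂ refl | inj₁ j'<i = ⊥-elim (ins-avoids (F (suc i)) _
        (trans (sym (wmap-old F i j' j'<i)) (trans (sym e) (wmap-new F i))))
  ... | inj₁ j<i | inj₂ refl = ⊥-elim (ins-avoids (F (suc i)) _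
        (trans (sym (wmap-old F i j j<i)) (trans e (wmap-new F i))))

  W-surjective : ∀ i → suc i ≤ m → ∀ v → 1 ≤ v → v ≤ suc i → ∃ λ j → j < suc i × W (suc i) j ≡ v
  W-surjective zero _ (suc zero) _ _ = 0 , s≤s z≤n , refl
  W-surjective zero _ (suc (suc v)) _ (s≤s ())
  W-surjective (suc i) i<m v 1≤v v≤ with <-cmp v (F (suc i))
  ... | tri≈ _ refl _ = suc i , ≤-refl , wmap-new F i
  ... | tri< v<c _ _ with W-surjective i (<⇒≤ i<m) v 1≤v (≤-pred (<-≤-trans v<c (proj₂ (central (suc i) i<m))))
  ...   | j , j< , e = j , m<n⇒m<1+n j< , trans (wmap-old F i j j<) (trans (cong (ins (F (suc i))) e) (ins-below v<c))
  W-surjective (suc i) i<m (suc v) 1≤v v≤ | tri> _ _ c<v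
    with W-surjective i (<⇒≤ i<m) v (≤-trans (proj₁ (central (suc i) i<m)) (≤-pred c<v)) (≤-pred v≤)
  ...   | j , j< , e = j , m<n⇒m<1+n j< , trans (wmap-old F i j j<) (trans (cong (ins (F (suc i))) e) (ins-above (≤-pred c<v)))

  inversions : ℕ → ℕ → ℕ
  inversions i j = countBelow i (λ k → (j <ᵇ k) ∧ (W i k <ᵇ W i j))

  -- The parking code: each later letter parked below raises W i j by one.
  W-code : ∀ i → suc i ≤ m → ∀ j → j < suc i → W (suc i) j ≡ F j + inversions (suc i) j
  W-code zero 1≤m zero _ = sym (trans (+-identityʳ (F 0)) F0≡1)
    where
    F0≡1 : F 0 ≡ 1
    F0≡1 = ≤-antisym (proj₂ (central 0 1≤m)) (proj₁ (central 0 1≤m))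
  W-code zero _ (suc j) (s≤s ())
  W-code (suc i) i<m j j< with m≤n⇒m<n∨m≡n (≤-pred j<)
  ... | inj₂ refl = sym (trans (cong (F (suc i) +_) (countBelow-none (suc (suc i)) none-later))
                              (trans (+-identityʳ _) (sym (wmap-new F i))))
    where
    none-later : ∀ k → k < suc (suc i) → ((suc i <ᵇ k) ∧ (W (suc (suc i)) k <ᵇ W (suc (suc i)) (suc i))) ≡ false
    none-later k k< rewrite <ᵇ-false {suc i} {k} (≤-pred k<) = refl
  ... | inj₁ j<i = begin
      W (suc (suc i)) j                        ≡⟨ wmap-old F i j j<i ⟩
      ins c v                                  ≡⟨ ins-shift c v ⟩
      v + ⟦ c <ᵇ ins c v ⟧                     ≡⟨ cong (_+ ⟦ c <ᵇ ins c v ⟧) (W-code i (<⇒≤ i<m) j j<i) ⟩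
      F j + inversions (suc i) j + ⟦ c <ᵇ ins c v ⟧
        ≡⟨ +-assoc (F j) _ _ ⟩
      F j + (inversions (suc i) j + ⟦ c <ᵇ ins c v ⟧)
        ≡⟨ cong (F j +_) (cong₂ _+_ (countBelow-ext (suc i) old-unchanged) new-counted) ⟩
      F j + inversions (suc (suc i)) j ∎
    where
    open ≡-Reasoning
    c = F (suc i)
    v = W (suc i) j
    later-below : ℕ → ℕ → Bool
    later-below i' k = (j <ᵇ k) ∧ (W i' k <ᵇ W i' j)
    old-unchanged : ∀ k → k < suc i → later-below (suc i) k ≡ later-below (suc (suc i)) k
    old-unchanged k k< = cong ((j <ᵇ k) ∧_)
      (sym (trans (cong₂ _<ᵇ_ (wmap-old F i k k<) (wmap-old F i j j<i)) (ins-order c _ _)))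
    new-counted : ⟦ c <ᵇ ins c v ⟧ ≡ ⟦ later-below (suc (suc i)) (suc i) ⟧
    new-counted rewrite <ᵇ-true {j} {suc i} j<i | wmap-new F i | wmap-old F i j j<i = refl

wmap-rank : ∀ m (P G : ℕ → ℕ) → (∀ x y → x < m → y < m → P x ≡ P y → x ≡ y) →
  (∀ x → x < m → G x ≡ suc (rank P x x)) →
  ∀ i → suc i ≤ m → ∀ j → j < suc i → wmap G (suc i) j ≡ suc (rank P (suc i) j)
wmap-rank m P G P-injective G-code = ranks
  where
  ranks : ∀ i → suc i ≤ m → ∀ j → j < suc i → wmap G (suc i) j ≡ suc (rank P (suc i) j)
  ranks zero _ zero _ rewrite <ᵇ-irrefl (P 0) = refl
  ranks zero _ (suc j) (s≤s ())
  ranks (suc i) i<m j j< with m≤n⇒m<n∨m≡n (≤-pred j<)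
  ... | inj₂ refl rewrite wmap-new G i | <ᵇ-irrefl (P (suc i)) | +-identityʳ (rank P (suc i) (suc i)) =
        G-code (suc i) i<m
  ... | inj₁ j<i rewrite wmap-old G i j j<i | ranks i (<⇒≤ i<m) j j<i | G-code (suc i) i<m
        with <-cmp (P j) (P (suc i))
  ...   | tri≈ _ e _ = ⊥-elim (<⇒≢ j<i (P-injective j (suc i) (<-trans j<i i<m) i<m e))
  ...   | tri< Pj<Pi _ _ rewrite <ᵇ-false {P (suc i)} {P j} (<⇒≤ Pj<Pi) =
          trans (ins-below (s≤s fewer)) (cong suc (sym (+-identityʳ _)))
    where
    fewer : rank P (suc i) j < rank P (suc i) (suc i)
    fewer = countBelow-strict (suc i) (λ k _ e → <ᵇ-true (<-trans (<ᵇ-sound e) Pj<Pi))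
              j j<i (<ᵇ-irrefl (P j)) (<ᵇ-true Pj<Pi)
  ...   | tri> _ _ Pi<Pj rewrite <ᵇ-true Pi<Pj =
          trans (ins-above (s≤s more)) (cong suc (+-comm 1 _))
    where
    more : rank P (suc i) (suc i) ≤ rank P (suc i) j
    more = countBelow-mono (suc i) (λ k _ e → <ᵇ-true (<-trans (<ᵇ-sound e) Pi<Pj))

at-toℕ : ∀ {m} (f : Fin m → ℕ) k → at f (toℕ k) ≡ f k
at-toℕ f fz = refl
at-toℕ f (fs k) = at-toℕ (λ k → f (fs k)) k

fin-to-ℕ : ∀ {m} {Q : ℕ → Set} → (∀ (k : Fin m) → Q (toℕ k)) → ∀ x → x < m → Q x
fin-to-ℕ {Q = Q} h x x<m = subst Q (toℕ-fromℕ< x<m) (h (fromℕ< x<m))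

fin-injective-to-ℕ : ∀ {m} (g : ℕ → ℕ) → (∀ (k k' : Fin m) → g (toℕ k) ≡ g (toℕ k') → k ≡ k') →
  ∀ x y → x < m → y < m → g x ≡ g y → x ≡ y
fin-injective-to-ℕ g inj x y x<m y<m = fin-to-ℕ {Q = λ x → g x ≡ g y → x ≡ y}
  (λ k → fin-to-ℕ {Q = λ y → g (toℕ k) ≡ g y → toℕ k ≡ y} (λ k' e → cong toℕ (inj k k' e)) y y<m) x x<m

count-ext : ∀ {m} {p q : Fin m → Bool} → (∀ k → p k ≡ q k) → count p ≡ count q
count-ext {zero} h = refl
count-ext {suc m} h = cong₂ _+_ (cong ⟦_⟧ (h fz)) (count-ext (λ k → h (fs k)))

count≡countBelow : ∀ m (p : ℕ → Bool) → count {m} (λ k → p (toℕ k)) ≡ countBelow m p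
count≡countBelow zero p = refl
count≡countBelow (suc m) p rewrite count≡countBelow m (λ k → p (suc k)) = sym (countBelow-front m p)

pick-spec : ∀ {m} (p : Fin m → Bool) (v : Fin m → ℕ) (k : Fin m) → p k ≡ true →
  ∃ λ k₀ → p k₀ ≡ true × pick p v ≡ v k₀
pick-spec p v fz pk rewrite pk = fz , pk , refl
pick-spec p v (fs k) pk with p fz in e
... | true = fz , e , refl
... | false with pick-spec (λ j → p (fs j)) (λ j → v (fs j)) k pk
...   | k₀ , pk₀ , r = fs k₀ , pk₀ , r

fz≢fs : ∀ {m} {i : Fin m} → fz ≢ fs i
fz≢fs ()

firstIndex-unique : ∀ {m} (w : Fin m → ℕ) x (i : Fin m) → w i ≡ x → (∀ i' → w i' ≡ x → i' ≡ i) →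
  firstIndex w x ≡ toℕ i
firstIndex-unique w x fz wi unique rewrite ≡ᵇ-true wi = refl
firstIndex-unique w x (fs i) wi unique rewrite ≡ᵇ-false {w fz} {x} (λ e → fz≢fs (unique fz e)) =
  cong suc (firstIndex-unique (λ j → w (fs j)) x i wi (λ i' e → fs-injective (unique (fs i') e)))

positive : ∀ {v} → 1 ≤ v → ∃ λ t → v ≡ suc t
positive {suc t} _ = t , refl

-- The two halves of the theorem for a fixed nonempty A = {a 0 < … < a (m-1)},
-- m = m' + 1 (for the empty alphabet both halves are vacuous).
module WithAlphabet (n m' : ℕ) (a : Fin (suc m') → ℕ) (increasing : IsSubsetSeq n (suc m') a) where

  m : ℕ
  m = suc m'

  a-order : ∀ j k → (a j <ᵇ a k) ≡ (toℕ j <ᵇ toℕ k)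
  a-order j k with <-cmp (toℕ j) (toℕ k)
  ... | tri< j<k _ _ rewrite <ᵇ-true j<k = <ᵇ-true (proj₂ increasing j k j<k)
  ... | tri≈ _ e _ rewrite toℕ-injective {i = j} {j = k} e | <ᵇ-irrefl (toℕ k) = <ᵇ-irrefl (a k)
  ... | tri> _ _ k<j rewrite <ᵇ-false {toℕ j} {toℕ k} (<⇒≤ k<j) = <ᵇ-false (<⇒≤ (proj₂ increasing k j k<j))

  a-injective : ∀ j k → a j ≡ a k → j ≡ k
  a-injective j k e with <-cmp (toℕ j) (toℕ k)
  ... | tri< j<k _ _ = ⊥-elim (<⇒≢ (proj₂ increasing j k j<k) e)
  ... | tri≈ _ e' _ = toℕ-injective e'
  ... | tri> _ _ k<j = ⊥-elim (<⇒≢ (proj₂ increasing k j k<j) (sym e))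

  contract-via : ∀ (w : Fin m → ℕ) (V : ℕ → ℕ) → (∀ k → winv w (a k) ≡ V (toℕ k)) → ∀ j →
    contract a w j ≡ V (toℕ j) ∸ countBelow m (λ l → (toℕ j <ᵇ l) ∧ (V l <ᵇ V (toℕ j)))
  contract-via w V position j = cong₂ _∸_ (position j)
    (trans (count-ext (λ k → cong₂ _∧_ (a-order j k) (cong₂ _<ᵇ_ (position k) (position j))))
           (count≡countBelow m (λ l → (toℕ j <ᵇ l) ∧ (V l <ᵇ V (toℕ j)))))

  contract-sparking : (f : Fin m → ℕ) → Central f → ∀ j → f j ≡ contract a (sparking a f) j
  contract-sparking f central j = sym (begin
    contract a w j                                       ≡⟨ contract-via w (W m) position j ⟩
    W m (toℕ j) ∸ inversions m (toℕ j)                   ≡⟨ cong (_∸ inversions m (toℕ j)) (W-code m' ≤-refl (toℕ j) (toℕ<n j)) ⟩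
    F (toℕ j) + inversions m (toℕ j) ∸ inversions m (toℕ j) ≡⟨ m+n∸n≡m (F (toℕ j)) (inversions m (toℕ j)) ⟩
    F (toℕ j)                                            ≡⟨ at-toℕ f j ⟩
    f j ∎)
    where
    open ≡-Reasoning
    F = at f
    open Parking F m (fin-to-ℕ λ k → subst (λ v → 1 ≤ v × v ≤ suc (toℕ k)) (sym (at-toℕ f k)) (central k))
    w = sparking a f

    letter : ∀ p → ∃ λ k → W m (toℕ k) ≡ suc (toℕ p) × w p ≡ a k
    letter p with W-surjective m' ≤-refl (suc (toℕ p)) (s≤s z≤n) (toℕ<n p)
    ... | x , x<m , e with pick-spec (λ k → W m (toℕ k) ≡ᵇ suc (toℕ p)) a (fromℕ< x<m)
                             (≡ᵇ-true (trans (cong (W m) (toℕ-fromℕ< x<m)) e))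
    ...   | k , ek , r = k , ≡ᵇ-sound ek , r

    letter-at : ∀ p k → w p ≡ a k → W m (toℕ k) ≡ suc (toℕ p)
    letter-at p k e with letter p
    ... | k₀ , e₀ , r = subst (λ k → W m (toℕ k) ≡ suc (toℕ p)) (a-injective k₀ k (trans (sym r) e)) e₀

    at-letter : ∀ p k → W m (toℕ k) ≡ suc (toℕ p) → w p ≡ a k
    at-letter p k e with letter p
    ... | k₀ , e₀ , r = trans r (cong a (toℕ-injective
          (W-injective m' ≤-refl (toℕ k₀) (toℕ k) (toℕ<n k₀) (toℕ<n k) (trans e₀ (sym e)))))

    position : ∀ k → winv w (a k) ≡ W m (toℕ k)
    position k with W-range m' ≤-refl (toℕ k) (toℕ<n k)
    ... | 1≤W , W≤m with positive 1≤W
    ...   | t , eW = trans (cong suc (firstIndex-unique w (a k) p (at-letter p k Wk≡p+1) unique)) (sym Wk≡p+1)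
      where
      t<m : t < m
      t<m = subst (_≤ m) eW W≤m
      p = fromℕ< t<m
      Wk≡p+1 : W m (toℕ k) ≡ suc (toℕ p)
      Wk≡p+1 = trans eW (cong suc (sym (toℕ-fromℕ< t<m)))
      unique : ∀ p' → w p' ≡ a k → p' ≡ p
      unique p' e = toℕ-injective (suc-injective (trans (sym (letter-at p' k e)) Wk≡p+1))

  sparking-contract : (w : Fin m → ℕ) → InW a w → ∀ i → w i ≡ sparking a (contract a w) i
  sparking-contract w (in-A , once) p = letter-restored
    where
    pos : Fin m → Fin m
    pos k = proj₁ (once k)
    pos-spec : ∀ k → w (pos k) ≡ a k
    pos-spec k = proj₁ (proj₂ (once k))
    pos-unique : ∀ k i → w i ≡ a k → i ≡ pos k
    pos-unique k = proj₂ (proj₂ (once k))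

    -- P x is the 0-based position of a x in w; it is a permutation of [0,m).
    P : ℕ → ℕ
    P = at (λ k → toℕ (pos k))
    P-fin : ∀ k → P (toℕ k) ≡ toℕ (pos k)
    P-fin = at-toℕ (λ k → toℕ (pos k))
    P-injective : ∀ x y → x < m → y < m → P x ≡ P y → x ≡ y
    P-injective = fin-injective-to-ℕ P λ k k' e → a-injective k k'
      (trans (sym (pos-spec k)) (trans (cong w (toℕ-injective (trans (sym (P-fin k)) (trans e (P-fin k'))))) (pos-spec k')))
    P-surjective : ∀ t → t < m → ∃ λ x → x < m × P x ≡ t
    P-surjective t t<m with in-A (fromℕ< t<m)
    ... | k , e = toℕ k , toℕ<n k , trans (P-fin k) (trans (cong toℕ (sym (pos-unique k _ e))) (toℕ-fromℕ< t<m))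
    P-rank : ∀ x → x < m → P x ≡ rank P m x
    P-rank x x<m = sym (permutation-rank m P P-injective P-surjective (P x)
      (<⇒≤ (fin-to-ℕ {Q = λ x → P x < m} (λ k → subst (_< m) (sym (P-fin k)) (toℕ<n (pos k))) x x<m)))

    -- The contraction of w is the left-inversion code of P ...
    G : ℕ → ℕ
    G = at (contract a w)
    G-code : ∀ x → x < m → G x ≡ suc (rank P x x)
    G-code = fin-to-ℕ λ k → trans (at-toℕ (contract a w) k)
      (trans (contract-via w (λ x → suc (P x)) position k) (right-inversions m P P-rank (toℕ k) (toℕ<n k)))
      where
      position : ∀ k → winv w (a k) ≡ suc (P (toℕ k))
      position k = cong suc (trans (firstIndex-unique w (a k) (pos k) (pos-spec k) (pos-unique k)) (sym (P-fin k)))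

    W-position : ∀ k → wmap G m (toℕ k) ≡ suc (toℕ (pos k))
    W-position k = trans (wmap-rank m P G P-injective G-code m' ≤-refl (toℕ k) (toℕ<n k))
                         (cong suc (trans (sym (P-rank (toℕ k) (toℕ<n k))) (P-fin k)))

    letter-restored : w p ≡ sparking a (contract a w) p
    letter-restored with in-A p
    ... | j , wp≡aj with pick-spec (λ k → wmap G m (toℕ k) ≡ᵇ suc (toℕ p)) a j
                           (≡ᵇ-true (trans (W-position j) (cong (λ q → suc (toℕ q)) (sym (pos-unique j p wp≡aj)))))
    ...   | k , ek , r = trans (cong w (sym pos-k≡p)) (trans (pos-spec k) (sym r))
      where
      pos-k≡p : pos k ≡ p
      pos-k≡p = toℕ-injective (suc-injective (trans (sym (W-position k)) (≡ᵇ-sound ek)))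

lemma4p2 : (n m : ℕ) (a : Fin m → ℕ) → IsSubsetSeq n m a →
    ((f : Fin m → ℕ) → Central f → ∀ j → f j ≡ contract a (sparking a f) j)
    × ((w : Fin m → ℕ) → InW a w → ∀ i → w i ≡ sparking a (contract a w) i)
lemma4p2 n zero a _ = (λ _ _ ()) , (λ _ _ ())
lemma4p2 n (suc m') a increasing = contract-sparking , sparking-contract
  where open WithAlphabet n m' a increasing
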